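{- Let $\lambda$ be a nonzero real number. For every $n \in \mathbb{N}$, \[ H_{n,\lambda}= \frac{1}{n!}\sum_{k=1}^n k\, (1)_{k-1,-\lambda}\begin{bmatrix}n\\ k\end{bmatrix}_\lambda. \]
   Context: For real $x$ and integer $k\ge0$, $\binom{x}{k}=\frac{x(x-1)\cdots(x-k+1)}{k!}$. Degenerate falling factorials: $(x)_{0,\mu}=1$, $(x)_{n,\mu}=x(x-\mu)(x-2\mu)\cdots(x-(n-1)\mu)$ for $n\ge1$; so $(1)_{k,-\lambda}=1(1+\lambda)\cdots(1+(k-1)\lambda)$. The degenerate logarithm is $\log_\lambda(1+t)=\frac{(1+t)^\lambda-1}{\lambda}=\sum_{n=1}^\infty\binom{\lambda-1}{n-1}\frac{t^n}{n}$. The unsigned degenerate Stirling numbers of the first kind ${n\brack k}_\lambda$ are defined by $\frac{1}{k!}\big(-\log_\lambda(1-t)\big)^k=\sum_{n=k}^\infty {n\brack k}_\lambda\frac{t^n}{n!}$ for $k\ge0$. The degenerate harmonic numbers are $H_{0,\lambda}=0$ and $H_{n,\lambda}=\sum_{k=1}^{n}\binom{\lambda-1}{k-1}\frac{(-1)^{k-1}}{k}$ for $n\in\mathbb{N}$. -}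

module Defs where

open import Level using (Level; _⊔_) renaming (suc to lsuc)
open import Data.Nat using (ℕ; zero; suc; _∸_)
open import Data.Nat using () renaming (_! to _!ℕ)
open import Relation.Nullary using (¬_)
open import Algebra.Bundles using (CommutativeRing)

module RingOps {c ℓ : Level} (R : CommutativeRing c ℓ) where
  open CommutativeRing R

  fromℕ : ℕ → Carrier
  fromℕ zero    = 0#
  fromℕ (suc n) = 1# + fromℕ n

  sumBelow : ℕ → (ℕ → Carrier) → Carrier
  sumBelow zero    f = 0#
  sumBelow (suc n) f = sumBelow n f + f n

  sum1to : ℕ → (ℕ → Carrier) → Carrier
  sum1to zero    f = 0#
  sum1to (suc n) f = sum1to n f + f (suc n)

  negOnePow : ℕ → Carrier
  negOnePow zero    = 1#
  negOnePow (suc m) = - negOnePow m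

  falling : Carrier → ℕ → Carrier
  falling x zero    = 1#
  falling x (suc k) = falling x k * (x + - fromℕ k)

  degFalling : Carrier → Carrier → ℕ → Carrier
  degFalling x μ zero    = 1#
  degFalling x μ (suc n) = degFalling x μ n * (x + - (fromℕ n * μ))

-- A field of characteristic zero, with a total inverse function
-- (0⁻¹ unspecified), e.g. the real numbers.
record CharZeroField (c ℓ : Level) : Set (lsuc (c ⊔ ℓ)) where
  field
    commutativeRing : CommutativeRing c ℓ
  open CommutativeRing commutativeRing public
  open RingOps commutativeRing public
  field
    _⁻¹        : Carrier → Carrier
    ⁻¹-inverse : ∀ x → ¬ (x ≈ 0#) → x * (x ⁻¹) ≈ 1#
    charZero   : ∀ n → ¬ (fromℕ (suc n) ≈ 0#)

module FieldDefs {c ℓ : Level} (F : CharZeroField c ℓ) where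
  open CharZeroField F

  binom : Carrier → ℕ → Carrier
  binom x k = falling x k * (fromℕ (k !ℕ) ⁻¹)

  degHarmonic : ℕ → Carrier → Carrier
  degHarmonic n lam =
    sum1to n (λ k → binom (lam + - 1#) (k ∸ 1) * negOnePow (k ∸ 1) * (fromℕ k ⁻¹))

  -- coefficient of t^m in -log_λ(1-t) = Σ_{m≥1} binom(λ-1,m-1) (-1)^{m-1} t^m / m
  negDegLogCoeff : Carrier → ℕ → Carrier
  negDegLogCoeff lam zero    = 0#
  negDegLogCoeff lam (suc m) =
    binom (lam + - 1#) m * negOnePow m * (fromℕ (suc m) ⁻¹)

  -- coefficient of t^n in (-log_λ(1-t))^k (formal power series product)
  powCoeff : Carrier → ℕ → ℕ → Carrier
  powCoeff lam zero    zero    = 1#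
  powCoeff lam zero    (suc n) = 0#
  powCoeff lam (suc k) n =
    sumBelow (suc n) (λ i → negDegLogCoeff lam i * powCoeff lam k (n ∸ i))

  -- unsigned degenerate Stirling numbers of the first kind [n k]_λ, defined by
  -- (1/k!) (-log_λ(1-t))^k = Σ_{n≥k} [n k]_λ t^n / n!,
  -- i.e. [n k]_λ = n!/k! · [t^n] (-log_λ(1-t))^k
  degStirling1 : Carrier → ℕ → ℕ → Carrier
  degStirling1 lam n k = fromℕ (n !ℕ) * (fromℕ (k !ℕ) ⁻¹) * powCoeff lam k n

-- Write f(t) = −log_λ(1 − t) = Σ aₘ tᵐ, so that [n k]_λ = n!/k! · [tⁿ] f(t)ᵏ, and let
-- βⱼ = (1)_{j,−λ}/j!, the coefficients of (1 − λy)^(−1/λ). The right-hand side is then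
-- Σ_{j<n} βⱼ [tⁿ] f(t)^(j+1). Since 1 − λ f(t) = (1 − t)^λ, the composite Σⱼ βⱼ f(t)ʲ is 1/(1 − t),
-- so the right-hand side is [tⁿ] f(t)/(1 − t) = a₁ + ⋯ + aₙ = H_{n,λ}.
--
-- Everything is proved on coefficients, starting from the differential equation (1 − t) f′ = 1 − λf.
-- It gives (1 − t)(fᵏ)′ = k fᵏ⁻¹ (1 − λf); together with (j + 1) βⱼ₊₁ = (1 + jλ) βⱼ this makes the
-- truncation g = Σ_{j<N} βⱼ fʲ satisfy (1 − t) g′ = g up to a term of order ≥ N − 1, so the
-- coefficients of g below N all equal g(0) = 1.

module Submission where

open import Data.Nat as ℕ using (ℕ; zero; suc; _∸_; _<_; _≤_; z≤n; s≤s; NonZero)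
open import Data.Nat using (_!)
import Data.Nat.Properties as ℕ
open import Data.Integer as ℤ using (ℤ; +_; -[1+_]; _⊖_; _◃_; sign; ∣_∣)
import Data.Integer.Properties as ℤ
open import Data.Sign as Sign using (Sign)
open import Data.Maybe using (Maybe; just; nothing)
open import Function using (_∘_)
open import Relation.Nullary using (¬_; yes; no)
open import Relation.Binary.PropositionalEquality as ≡ using (_≡_)
open import Algebra.Bundles using (CommutativeRing)
open import Algebra.Solver.Ring.AlmostCommutativeRing
  using (fromCommutativeRing; _-Raw-AlmostCommutative⟶_)
open import Defs

module FromℕProperties {c ℓ} (R : CommutativeRing c ℓ) where
  open CommutativeRing R
  open RingOps R using (fromℕ)
  open import Relation.Binary.Reasoning.Setoid setoid

  fromℕ-+ : ∀ m n → fromℕ (m ℕ.+ n) ≈ fromℕ m + fromℕ n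
  fromℕ-+ zero    n = sym (+-identityˡ _)
  fromℕ-+ (suc m) n = trans (+-congˡ (fromℕ-+ m n)) (sym (+-assoc _ _ _))

  fromℕ-* : ∀ m n → fromℕ (m ℕ.* n) ≈ fromℕ m * fromℕ n
  fromℕ-* zero    n = sym (zeroˡ _)
  fromℕ-* (suc m) n = begin
    fromℕ (n ℕ.+ m ℕ.* n)            ≈⟨ fromℕ-+ n (m ℕ.* n) ⟩
    fromℕ n + fromℕ (m ℕ.* n)        ≈⟨ +-cong (sym (*-identityˡ _)) (fromℕ-* m n) ⟩
    1# * fromℕ n + fromℕ m * fromℕ n ≈⟨ distribʳ _ _ _ ⟨
    (1# + fromℕ m) * fromℕ n         ∎

module IntegerCoefficientSolver {c ℓ} (R : CommutativeRing c ℓ) where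
  open CommutativeRing R
  open import Relation.Binary.Reasoning.Setoid setoid
  open import Algebra.Properties.Ring ring using (-‿involutive; -0#≈0#; -1*x≈-x)
  open import Algebra.Properties.AbelianGroup +-abelianGroup using (⁻¹-∙-comm)
  open import Algebra.Properties.CommutativeSemigroup +-commutativeSemigroup
    using () renaming (interchange to +-interchange)
  open import Algebra.Properties.CommutativeSemigroup *-commutativeSemigroup
    using () renaming (interchange to *-interchange)
  open import Algebra.Properties.Semiring.Mult.TCOptimised semiring using (_×_; 1+×; ×-homo-+; ×1-homo-*)

  -- Coefficients are read through the optimised _×_, for which 1 × 1# reduces to 1#, so that the
  -- constants 0, 1 and −1 of a polynomial denote 0#, 1# and - 1# definitionally.
  fromℤ : ℤ → Carrier
  fromℤ (+ n)      = n × 1#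
  fromℤ -[1+ n ] = - (suc n × 1#)

  fromSign : Sign → Carrier
  fromSign Sign.+ = 1#
  fromSign Sign.- = - 1#

  fromℤ-⊖ : ∀ m n → fromℤ (m ⊖ n) ≈ m × 1# - n × 1#
  fromℤ-⊖ m       zero    = sym (trans (+-congˡ -0#≈0#) (+-identityʳ _))
  fromℤ-⊖ zero    (suc n) = sym (+-identityˡ _)
  fromℤ-⊖ (suc m) (suc n) = begin
    fromℤ (suc m ⊖ suc n)                 ≡⟨ ≡.cong fromℤ (ℤ.[1+m]⊖[1+n]≡m⊖n m n) ⟩
    fromℤ (m ⊖ n)                         ≈⟨ fromℤ-⊖ m n ⟩
    m × 1# - n × 1#                       ≈⟨ +-identityˡ _ ⟨
    0# + (m × 1# - n × 1#)                ≈⟨ +-congʳ (-‿inverseʳ 1#) ⟨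
    (1# - 1#) + (m × 1# - n × 1#)         ≈⟨ +-interchange _ _ _ _ ⟩
    (1# + m × 1#) + (- 1# + - (n × 1#))   ≈⟨ +-cong (1+× m 1#) (trans (-‿cong (1+× n 1#)) (sym (⁻¹-∙-comm _ _))) ⟨
    suc m × 1# - suc n × 1#               ∎

  fromℤ-+ : ∀ i j → fromℤ (i ℤ.+ j) ≈ fromℤ i + fromℤ j
  fromℤ-+ (+ m)    (+ n)    = ×-homo-+ 1# m n
  fromℤ-+ (+ m)    -[1+ n ] = fromℤ-⊖ m (suc n)
  fromℤ-+ -[1+ m ] (+ n)    = trans (fromℤ-⊖ n (suc m)) (+-comm _ _)
  fromℤ-+ -[1+ m ] -[1+ n ] = begin
    - (suc (suc (m ℕ.+ n)) × 1#)          ≡⟨ ≡.cong (λ k → - (suc k × 1#)) (ℕ.+-suc m n) ⟨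
    - ((suc m ℕ.+ suc n) × 1#)            ≈⟨ -‿cong (×-homo-+ 1# (suc m) (suc n)) ⟩
    - (suc m × 1# + suc n × 1#)           ≈⟨ ⁻¹-∙-comm _ _ ⟨
    - (suc m × 1#) + - (suc n × 1#)       ∎

  fromℤ-◃ : ∀ s n → fromℤ (s ◃ n) ≈ fromSign s * (n × 1#)
  fromℤ-◃ s      zero    = sym (zeroʳ _)
  fromℤ-◃ Sign.+ (suc n) = sym (*-identityˡ _)
  fromℤ-◃ Sign.- (suc n) = sym (-1*x≈-x _)

  fromℤ≈sign*abs : ∀ i → fromℤ i ≈ fromSign (sign i) * (∣ i ∣ × 1#)
  fromℤ≈sign*abs (+ n)    = sym (*-identityˡ _)
  fromℤ≈sign*abs -[1+ n ] = sym (-1*x≈-x _)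

  fromSign-* : ∀ s t → fromSign (s Sign.* t) ≈ fromSign s * fromSign t
  fromSign-* Sign.+ t      = sym (*-identityˡ _)
  fromSign-* Sign.- Sign.+ = sym (*-identityʳ _)
  fromSign-* Sign.- Sign.- = sym (trans (-1*x≈-x _) (-‿involutive 1#))

  fromℤ-* : ∀ i j → fromℤ (i ℤ.* j) ≈ fromℤ i * fromℤ j
  fromℤ-* i j = begin
    fromℤ (sign i Sign.* sign j ◃ ∣ i ∣ ℕ.* ∣ j ∣)
      ≈⟨ fromℤ-◃ (sign i Sign.* sign j) (∣ i ∣ ℕ.* ∣ j ∣) ⟩
    fromSign (sign i Sign.* sign j) * ((∣ i ∣ ℕ.* ∣ j ∣) × 1#)
      ≈⟨ *-cong (fromSign-* (sign i) (sign j)) (×1-homo-* ∣ i ∣ ∣ j ∣) ⟩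
    (fromSign (sign i) * fromSign (sign j)) * ((∣ i ∣ × 1#) * (∣ j ∣ × 1#))
      ≈⟨ *-interchange _ _ _ _ ⟩
    (fromSign (sign i) * (∣ i ∣ × 1#)) * (fromSign (sign j) * (∣ j ∣ × 1#))
      ≈⟨ *-cong (fromℤ≈sign*abs i) (fromℤ≈sign*abs j) ⟨
    fromℤ i * fromℤ j
      ∎

  fromℤ-neg : ∀ i → fromℤ (ℤ.- i) ≈ - fromℤ i
  fromℤ-neg (+ zero)  = sym -0#≈0#
  fromℤ-neg (+ suc n) = refl
  fromℤ-neg -[1+ n ]  = sym (-‿involutive _)

  homomorphism : ℤ.+-*-rawRing -Raw-AlmostCommutative⟶ fromCommutativeRing R
  homomorphism = record
    { ⟦_⟧    = fromℤ
    ; +-homo = fromℤ-+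
    ; *-homo = fromℤ-*
    ; -‿homo = fromℤ-neg
    ; 0-homo = refl
    ; 1-homo = refl
    }

  fromℤ-≈? : ∀ i j → Maybe (fromℤ i ≈ fromℤ j)
  fromℤ-≈? i j with i ℤ.≟ j
  ... | yes ≡.refl = just refl
  ... | no  _      = nothing

  open import Algebra.Solver.Ring ℤ.+-*-rawRing (fromCommutativeRing R) homomorphism fromℤ-≈? public

module SumBelowProperties {c ℓ} (R : CommutativeRing c ℓ) where
  open CommutativeRing R
  open RingOps R using (sumBelow; sum1to)
  open IntegerCoefficientSolver R using (solve; _:+_; _:-_; _:=_)
  open import Relation.Binary.Reasoning.Setoid setoid

  sumBelow-cong : ∀ N {f g : ℕ → Carrier} → (∀ i → i < N → f i ≈ g i) → sumBelow N f ≈ sumBelow N g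
  sumBelow-cong zero    f≈g = refl
  sumBelow-cong (suc N) f≈g = +-cong (sumBelow-cong N (λ i i<N → f≈g i (ℕ.m<n⇒m<1+n i<N))) (f≈g N (ℕ.n<1+n N))

  sumBelow-zero : ∀ N {f : ℕ → Carrier} → (∀ i → i < N → f i ≈ 0#) → sumBelow N f ≈ 0#
  sumBelow-zero N f≈0 = trans (sumBelow-cong N f≈0) (sumBelow-zero′ N)
    where
    sumBelow-zero′ : ∀ N → sumBelow N (λ _ → 0#) ≈ 0#
    sumBelow-zero′ zero    = refl
    sumBelow-zero′ (suc N) = trans (+-identityʳ _) (sumBelow-zero′ N)

  sumBelow-distrib-+ : ∀ N (f g : ℕ → Carrier) → sumBelow N (λ i → f i + g i) ≈ sumBelow N f + sumBelow N g
  sumBelow-distrib-+ zero    f g = sym (+-identityʳ 0#)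
  sumBelow-distrib-+ (suc N) f g = begin
    sumBelow N (λ i → f i + g i) + (f N + g N)         ≈⟨ +-congʳ (sumBelow-distrib-+ N f g) ⟩
    (sumBelow N f + sumBelow N g) + (f N + g N)        ≈⟨ solve 4 (λ x y z w → (x :+ y) :+ (z :+ w) := (x :+ z) :+ (y :+ w)) refl _ _ _ _ ⟩
    (sumBelow N f + f N) + (sumBelow N g + g N)        ∎

  sumBelow-distrib-- : ∀ N (f g : ℕ → Carrier) → sumBelow N (λ i → f i - g i) ≈ sumBelow N f - sumBelow N g
  sumBelow-distrib-- zero    f g = sym (-‿inverseʳ 0#)
  sumBelow-distrib-- (suc N) f g = begin
    sumBelow N (λ i → f i - g i) + (f N - g N)         ≈⟨ +-congʳ (sumBelow-distrib-- N f g) ⟩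
    (sumBelow N f - sumBelow N g) + (f N - g N)        ≈⟨ solve 4 (λ x y z w → (x :- y) :+ (z :- w) := (x :+ z) :- (y :+ w)) refl _ _ _ _ ⟩
    (sumBelow N f + f N) - (sumBelow N g + g N)        ∎

  *-distribˡ-sumBelow : ∀ N x (f : ℕ → Carrier) → x * sumBelow N f ≈ sumBelow N (λ i → x * f i)
  *-distribˡ-sumBelow zero    x f = zeroʳ x
  *-distribˡ-sumBelow (suc N) x f = trans (distribˡ _ _ _) (+-congʳ (*-distribˡ-sumBelow N x f))

  sumBelow-head : ∀ N (f : ℕ → Carrier) → sumBelow (suc N) f ≈ f 0 + sumBelow N (f ∘ suc)
  sumBelow-head zero    f = +-comm _ _
  sumBelow-head (suc N) f = trans (+-congʳ (sumBelow-head N f)) (+-assoc _ _ _)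

  sumBelow-comm : ∀ M N (f : ℕ → ℕ → Carrier) →
                  sumBelow M (λ i → sumBelow N (f i)) ≈ sumBelow N (λ j → sumBelow M (λ i → f i j))
  sumBelow-comm zero    N f = sym (sumBelow-zero N (λ _ _ → refl))
  sumBelow-comm (suc M) N f = trans (+-congʳ (sumBelow-comm M N f)) (sym (sumBelow-distrib-+ N _ _))

  sumBelow-telescope : ∀ N (e : ℕ → Carrier) → sumBelow N (λ j → e j - e (suc j)) ≈ e 0 - e N
  sumBelow-telescope zero    e = sym (-‿inverseʳ _)
  sumBelow-telescope (suc N) e = trans (+-congʳ (sumBelow-telescope N e))
    (solve 3 (λ x y z → (x :- y) :+ (y :- z) := x :- z) refl _ _ _)

  sum1to≈sumBelow : ∀ n (f : ℕ → Carrier) → sum1to n f ≈ sumBelow n (f ∘ suc)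
  sum1to≈sumBelow zero    f = refl
  sum1to≈sumBelow (suc n) f = +-congʳ (sum1to≈sumBelow n f)

-- A sequence u : ℕ → Carrier stands for the formal power series Σ u n tⁿ.
module Convolution {c ℓ} (R : CommutativeRing c ℓ) where
  open CommutativeRing R
  open RingOps R using (fromℕ; sumBelow)
  open FromℕProperties R
  open SumBelowProperties R
  open IntegerCoefficientSolver R using (solve; _:+_; _:*_; _:-_; _:=_)
  open import Algebra.Properties.Ring ring using (x[y-z]≈xy-xz; [y-z]x≈yx-zx)
  open import Algebra.Properties.CommutativeSemigroup *-commutativeSemigroup using (x∙yz≈y∙xz)
  open import Relation.Binary.Reasoning.Setoid setoid

  infixl 7 _⋆_
  _⋆_ : (ℕ → Carrier) → (ℕ → Carrier) → ℕ → Carrier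
  (u ⋆ v) n = sumBelow (suc n) (λ i → u i * v (n ∸ i))

  δ : ℕ → Carrier
  δ zero    = 1#
  δ (suc _) = 0#

  euler : (ℕ → Carrier) → ℕ → Carrier
  euler u n = fromℕ n * u n

  -- D u is the coefficient sequence of (1 − t) u′(t).
  D : (ℕ → Carrier) → ℕ → Carrier
  D u n = euler u (suc n) - euler u n

  ⋆-congˡ : ∀ {u u′} v n → (∀ i → u i ≈ u′ i) → (u ⋆ v) n ≈ (u′ ⋆ v) n
  ⋆-congˡ v n u≈u′ = sumBelow-cong (suc n) (λ i _ → *-congʳ (u≈u′ i))

  ⋆-congʳ : ∀ u {v v′} n → (∀ m → v m ≈ v′ m) → (u ⋆ v) n ≈ (u ⋆ v′) n
  ⋆-congʳ u n v≈v′ = sumBelow-cong (suc n) (λ i _ → *-congˡ (v≈v′ (n ∸ i)))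

  ⋆-identityˡ : ∀ v n → (δ ⋆ v) n ≈ v n
  ⋆-identityˡ v n = begin
    (δ ⋆ v) n                                        ≈⟨ sumBelow-head n _ ⟩
    1# * v n + sumBelow n (λ i → 0# * v (n ∸ suc i)) ≈⟨ +-cong (*-identityˡ _) (sumBelow-zero n (λ _ _ → zeroˡ _)) ⟩
    v n + 0#                                         ≈⟨ +-identityʳ _ ⟩
    v n                                              ∎

  ⋆-homogeneousˡ : ∀ x u v n → ((λ i → x * u i) ⋆ v) n ≈ x * (u ⋆ v) n
  ⋆-homogeneousˡ x u v n = trans (sumBelow-cong (suc n) (λ i _ → *-assoc _ _ _)) (sym (*-distribˡ-sumBelow (suc n) x _))

  ⋆-homogeneousʳ : ∀ x u v n → (u ⋆ (λ m → x * v m)) n ≈ x * (u ⋆ v) n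
  ⋆-homogeneousʳ x u v n = trans (sumBelow-cong (suc n) (λ i _ → x∙yz≈y∙xz _ _ _)) (sym (*-distribˡ-sumBelow (suc n) x _))

  ⋆-distribʳ-- : ∀ u u′ v n → ((λ i → u i - u′ i) ⋆ v) n ≈ (u ⋆ v) n - (u′ ⋆ v) n
  ⋆-distribʳ-- u u′ v n = trans (sumBelow-cong (suc n) (λ i _ → [y-z]x≈yx-zx _ _ _)) (sumBelow-distrib-- (suc n) _ _)

  ⋆-distribˡ-- : ∀ u v v′ n → (u ⋆ (λ m → v m - v′ m)) n ≈ (u ⋆ v) n - (u ⋆ v′) n
  ⋆-distribˡ-- u v v′ n = trans (sumBelow-cong (suc n) (λ i _ → x[y-z]≈xy-xz _ _ _)) (sumBelow-distrib-- (suc n) _ _)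

  euler-⋆ : ∀ u v n → euler (u ⋆ v) n ≈ (euler u ⋆ v) n + (u ⋆ euler v) n
  euler-⋆ u v n = begin
    fromℕ n * (u ⋆ v) n                                             ≈⟨ *-distribˡ-sumBelow (suc n) _ _ ⟩
    sumBelow (suc n) (λ i → fromℕ n * (u i * v (n ∸ i)))            ≈⟨ sumBelow-cong (suc n) (λ i i≤n → split i (ℕ.s≤s⁻¹ i≤n)) ⟩
    sumBelow (suc n) (λ i → euler u i * v (n ∸ i) + u i * euler v (n ∸ i)) ≈⟨ sumBelow-distrib-+ (suc n) _ _ ⟩
    (euler u ⋆ v) n + (u ⋆ euler v) n                               ∎
    where
    split : ∀ i → i ≤ n → fromℕ n * (u i * v (n ∸ i)) ≈ euler u i * v (n ∸ i) + u i * euler v (n ∸ i)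
    split i i≤n = begin
      fromℕ n * (u i * v (n ∸ i))                      ≡⟨ ≡.cong (λ k → fromℕ k * (u i * v (n ∸ i))) (ℕ.m+[n∸m]≡n i≤n) ⟨
      fromℕ (i ℕ.+ (n ∸ i)) * (u i * v (n ∸ i))        ≈⟨ *-congʳ (fromℕ-+ i (n ∸ i)) ⟩
      (fromℕ i + fromℕ (n ∸ i)) * (u i * v (n ∸ i))    ≈⟨ solve 4 (λ a b x y → (a :+ b) :* (x :* y) := (a :* x) :* y :+ x :* (b :* y)) refl _ _ _ _ ⟩
      euler u i * v (n ∸ i) + u i * euler v (n ∸ i)    ∎

  ⋆-sucˡ : ∀ u v n → u 0 ≈ 0# → (u ⋆ v) (suc n) ≈ ((u ∘ suc) ⋆ v) n
  ⋆-sucˡ u v n u₀≈0 = begin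
    (u ⋆ v) (suc n)                   ≈⟨ sumBelow-head (suc n) _ ⟩
    u 0 * v (suc n) + ((u ∘ suc) ⋆ v) n ≈⟨ +-congʳ (trans (*-congʳ u₀≈0) (zeroˡ _)) ⟩
    0# + ((u ∘ suc) ⋆ v) n            ≈⟨ +-identityˡ _ ⟩
    ((u ∘ suc) ⋆ v) n                 ∎

  ⋆-sucʳ : ∀ u v n → v 0 ≈ 0# → (u ⋆ v) (suc n) ≈ (u ⋆ (v ∘ suc)) n
  ⋆-sucʳ u v n v₀≈0 = begin
    (u ⋆ v) (suc n)                                          ≡⟨⟩
    sumBelow (suc n) (λ i → u i * v (suc n ∸ i)) + u (suc n) * v (n ∸ n)
      ≈⟨ +-cong (sumBelow-cong (suc n) (λ i i≤n → *-congˡ (v-shift i (ℕ.s≤s⁻¹ i≤n)))) last≈0 ⟩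
    (u ⋆ (v ∘ suc)) n + 0#                                   ≈⟨ +-identityʳ _ ⟩
    (u ⋆ (v ∘ suc)) n                                        ∎
    where
    v-shift : ∀ i → i ≤ n → v (suc n ∸ i) ≈ v (suc (n ∸ i))
    v-shift i i≤n = reflexive (≡.cong v (ℕ.+-∸-assoc 1 i≤n))
    last≈0 : u (suc n) * v (n ∸ n) ≈ 0#
    last≈0 = trans (*-congˡ (trans (reflexive (≡.cong v (ℕ.n∸n≡0 n))) v₀≈0)) (zeroʳ _)

  D-⋆ : ∀ u v n → D (u ⋆ v) n ≈ (D u ⋆ v) n + (u ⋆ D v) n
  D-⋆ u v n = begin
    euler (u ⋆ v) (suc n) - euler (u ⋆ v) n
      ≈⟨ +-cong (euler-⋆ u v (suc n)) (-‿cong (euler-⋆ u v n)) ⟩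
    ((euler u ⋆ v) (suc n) + (u ⋆ euler v) (suc n)) - ((euler u ⋆ v) n + (u ⋆ euler v) n)
      ≈⟨ +-congʳ (+-cong (⋆-sucˡ (euler u) v n (zeroˡ _)) (⋆-sucʳ u (euler v) n (zeroˡ _))) ⟩
    ((euler u ∘ suc) ⋆ v) n + (u ⋆ (euler v ∘ suc)) n - ((euler u ⋆ v) n + (u ⋆ euler v) n)
      ≈⟨ solve 4 (λ a b c d → (a :+ b) :- (c :+ d) := (a :- c) :+ (b :- d)) refl _ _ _ _ ⟩
    (((euler u ∘ suc) ⋆ v) n - (euler u ⋆ v) n) + ((u ⋆ (euler v ∘ suc)) n - (u ⋆ euler v) n)
      ≈⟨ +-cong (⋆-distribʳ-- (euler u ∘ suc) (euler u) v n) (⋆-distribˡ-- u (euler v ∘ suc) (euler v) n) ⟨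
    (D u ⋆ v) n + (u ⋆ D v) n
      ∎

  ⋆-vanish : ∀ u v k n → u 0 ≈ 0# → (∀ m → m < k → v m ≈ 0#) → n ≤ k → (u ⋆ v) n ≈ 0#
  ⋆-vanish u v k n u₀≈0 v≈0 n≤k = sumBelow-zero (suc n) term≈0
    where
    term≈0 : ∀ i → i < suc n → u i * v (n ∸ i) ≈ 0#
    term≈0 zero    _       = trans (*-congʳ u₀≈0) (zeroˡ _)
    term≈0 (suc i) i<1+n = trans (*-congˡ (v≈0 (n ∸ suc i) n∸[1+i]<k)) (zeroʳ _)
      where
      n∸[1+i]<k : n ∸ suc i < k
      n∸[1+i]<k = ℕ.<-≤-trans (ℕ.∸-monoʳ-< {o = 0} (s≤s z≤n) (ℕ.s≤s⁻¹ i<1+n)) n≤k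

  sumBelow-⋆ʳ : ∀ N (w : ℕ → Carrier) u (v : ℕ → ℕ → Carrier) n →
                sumBelow N (λ j → w j * (u ⋆ v j) n) ≈ (u ⋆ (λ m → sumBelow N (λ j → w j * v j m))) n
  sumBelow-⋆ʳ N w u v n = begin
    sumBelow N (λ j → w j * (u ⋆ v j) n)
      ≈⟨ sumBelow-cong N (λ j _ → sym (⋆-homogeneousʳ (w j) u (v j) n)) ⟩
    sumBelow N (λ j → sumBelow (suc n) (λ i → u i * (w j * v j (n ∸ i))))
      ≈⟨ sumBelow-comm N (suc n) _ ⟩
    sumBelow (suc n) (λ i → sumBelow N (λ j → u i * (w j * v j (n ∸ i))))
      ≈⟨ sumBelow-cong (suc n) (λ i _ → sym (*-distribˡ-sumBelow N (u i) _)) ⟩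
    (u ⋆ (λ m → sumBelow N (λ j → w j * v j m))) n
      ∎

  ⋆-partialSum : ∀ u v n → u 0 ≈ 0# → (∀ m → m < n → v m ≈ 1#) → (u ⋆ v) n ≈ sumBelow n (u ∘ suc)
  ⋆-partialSum u v n u₀≈0 v≈1 = begin
    (u ⋆ v) n                                         ≈⟨ sumBelow-head n _ ⟩
    u 0 * v n + sumBelow n (λ i → u (suc i) * v (n ∸ suc i))
      ≈⟨ +-cong (trans (*-congʳ u₀≈0) (zeroˡ _)) (sumBelow-cong n (λ i i<n → trans (*-congˡ (v≈1 _ (n∸[1+i]<n i i<n))) (*-identityʳ _))) ⟩
    0# + sumBelow n (u ∘ suc)                         ≈⟨ +-identityˡ _ ⟩
    sumBelow n (u ∘ suc)                              ∎
    where
    n∸[1+i]<n : ∀ i → i < n → n ∸ suc i < n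
    n∸[1+i]<n i i<n = ℕ.∸-monoʳ-< {o = 0} (s≤s z≤n) i<n

module CharZeroFieldProperties {c ℓ} (F : CharZeroField c ℓ) where
  open CharZeroField F
  open FieldDefs F using (binom)
  open FromℕProperties commutativeRing
  open IntegerCoefficientSolver commutativeRing using (solve; _:*_; _:=_)
  open import Relation.Binary.Reasoning.Setoid setoid

  fromℕ-≉0 : ∀ n → .{{NonZero n}} → ¬ fromℕ n ≈ 0#
  fromℕ-≉0 (suc n) = charZero n

  ⁻¹-unique : ∀ {x y} → ¬ x ≈ 0# → x * y ≈ 1# → y ≈ x ⁻¹
  ⁻¹-unique {x} {y} x≉0 xy≈1 = begin
    y                ≈⟨ *-identityʳ y ⟨
    y * 1#           ≈⟨ *-congˡ (⁻¹-inverse x x≉0) ⟨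
    y * (x * x ⁻¹)   ≈⟨ solve 3 (λ y x x⁻¹ → y :* (x :* x⁻¹) := (x :* y) :* x⁻¹) refl y x (x ⁻¹) ⟩
    (x * y) * x ⁻¹   ≈⟨ *-congʳ xy≈1 ⟩
    1# * x ⁻¹        ≈⟨ *-identityˡ _ ⟩
    x ⁻¹             ∎

  ⁻¹-*-cancelˡ : ∀ {x} y → ¬ x ≈ 0# → x ⁻¹ * (x * y) ≈ y
  ⁻¹-*-cancelˡ {x} y x≉0 = begin
    x ⁻¹ * (x * y)   ≈⟨ solve 3 (λ x⁻¹ x y → x⁻¹ :* (x :* y) := (x :* x⁻¹) :* y) refl (x ⁻¹) x y ⟩
    (x * x ⁻¹) * y   ≈⟨ *-congʳ (⁻¹-inverse x x≉0) ⟩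
    1# * y           ≈⟨ *-identityˡ y ⟩
    y                ∎

  *-cancelˡ : ∀ {x y z} → ¬ x ≈ 0# → x * y ≈ x * z → y ≈ z
  *-cancelˡ {x} {y} {z} x≉0 xy≈xz = begin
    y                ≈⟨ ⁻¹-*-cancelˡ y x≉0 ⟨
    x ⁻¹ * (x * y)   ≈⟨ *-congˡ xy≈xz ⟩
    x ⁻¹ * (x * z)   ≈⟨ ⁻¹-*-cancelˡ z x≉0 ⟩
    z                ∎

  fromℕ-1⁻¹ : fromℕ 1 ⁻¹ ≈ 1#
  fromℕ-1⁻¹ = sym (⁻¹-unique (charZero 0) (trans (*-identityʳ _) (+-identityʳ 1#)))

  fromℕ-!-suc⁻¹ : ∀ m → fromℕ (suc m !) ⁻¹ ≈ fromℕ (m !) ⁻¹ * fromℕ (suc m) ⁻¹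
  fromℕ-!-suc⁻¹ m = sym (⁻¹-unique (fromℕ-≉0 (suc m !) {{ℕ._!≢0 (suc m)}}) (begin
    fromℕ (suc m !) * (m!⁻¹ * s⁻¹)        ≈⟨ *-congʳ (fromℕ-* (suc m) (m !)) ⟩
    (s * m!) * (m!⁻¹ * s⁻¹)               ≈⟨ solve 4 (λ s m! m!⁻¹ s⁻¹ → (s :* m!) :* (m!⁻¹ :* s⁻¹) := (s :* s⁻¹) :* (m! :* m!⁻¹)) refl s m! m!⁻¹ s⁻¹ ⟩
    (s * s⁻¹) * (m! * m!⁻¹)               ≈⟨ *-cong (⁻¹-inverse s (charZero m)) (⁻¹-inverse m! (fromℕ-≉0 (m !) {{ℕ._!≢0 m}})) ⟩
    1# * 1#                               ≈⟨ *-identityʳ 1# ⟩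
    1#                                    ∎))
    where
    s s⁻¹ m! m!⁻¹ : Carrier
    s    = fromℕ (suc m)
    s⁻¹  = s ⁻¹
    m!   = fromℕ (m !)
    m!⁻¹ = m! ⁻¹

  fromℕ-suc*!-suc⁻¹ : ∀ m → fromℕ (suc m) * fromℕ (suc m !) ⁻¹ ≈ fromℕ (m !) ⁻¹
  fromℕ-suc*!-suc⁻¹ m = begin
    s * fromℕ (suc m !) ⁻¹        ≈⟨ *-congˡ (fromℕ-!-suc⁻¹ m) ⟩
    s * (fromℕ (m !) ⁻¹ * s ⁻¹)   ≈⟨ solve 3 (λ s m!⁻¹ s⁻¹ → s :* (m!⁻¹ :* s⁻¹) := m!⁻¹ :* (s :* s⁻¹)) refl s (fromℕ (m !) ⁻¹) (s ⁻¹) ⟩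
    fromℕ (m !) ⁻¹ * (s * s ⁻¹)   ≈⟨ *-congˡ (⁻¹-inverse s (charZero m)) ⟩
    fromℕ (m !) ⁻¹ * 1#           ≈⟨ *-identityʳ _ ⟩
    fromℕ (m !) ⁻¹                ∎
    where
    s : Carrier
    s = fromℕ (suc m)

  binom-suc : ∀ x m → binom x (suc m) ≈ binom x m * (x - fromℕ m) * fromℕ (suc m) ⁻¹
  binom-suc x m = begin
    falling x m * (x - fromℕ m) * fromℕ (suc m !) ⁻¹
      ≈⟨ *-congˡ (fromℕ-!-suc⁻¹ m) ⟩
    falling x m * (x - fromℕ m) * (fromℕ (m !) ⁻¹ * fromℕ (suc m) ⁻¹)
      ≈⟨ solve 4 (λ f y a b → f :* y :* (a :* b) := f :* a :* y :* b) refl _ _ _ _ ⟩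
    falling x m * fromℕ (m !) ⁻¹ * (x - fromℕ m) * fromℕ (suc m) ⁻¹
      ∎

module DegenerateLogSeries {c ℓ} (F : CharZeroField c ℓ) (lam : CharZeroField.Carrier F) where
  open CharZeroField F
  open FieldDefs F
  open CharZeroFieldProperties F
  open SumBelowProperties commutativeRing
  open Convolution commutativeRing
  open IntegerCoefficientSolver commutativeRing using (solve; _:+_; _:*_; _:-_; :-_; _:=_; con)
  open import Algebra.Properties.Ring ring using (x[y-z]≈xy-xz; -0#≈0#)
  open import Relation.Binary.Reasoning.Setoid setoid

  a : ℕ → Carrier
  a = negDegLogCoeff lam

  P : ℕ → ℕ → Carrier
  P = powCoeff lam

  negDegLogCoeff-1 : a 1 ≈ 1#
  negDegLogCoeff-1 = begin
    (1# * fromℕ 1 ⁻¹) * 1# * fromℕ 1 ⁻¹ ≈⟨ *-cong (*-congʳ (*-congˡ fromℕ-1⁻¹)) fromℕ-1⁻¹ ⟩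
    (1# * 1#) * 1# * 1#                 ≈⟨ solve 0 (con (+ 1) :* con (+ 1) :* con (+ 1) :* con (+ 1) := con (+ 1)) refl ⟩
    1#                                  ∎

  negDegLogCoeff-suc : ∀ m → fromℕ (suc (suc m)) * a (suc (suc m)) ≈ (fromℕ (suc m) - lam) * a (suc m)
  negDegLogCoeff-suc m = begin
    s′ * (binom x (suc m) * - N * s′ ⁻¹)          ≈⟨ solve 4 (λ s′ b N s′⁻¹ → s′ :* (b :* :- N :* s′⁻¹) := (s′ :* s′⁻¹) :* (b :* :- N)) refl s′ _ N _ ⟩
    (s′ * s′ ⁻¹) * (binom x (suc m) * - N)        ≈⟨ *-cong (⁻¹-inverse s′ (charZero (suc m))) (*-congʳ (binom-suc x m)) ⟩
    1# * (binom x m * (x - fromℕ m) * s ⁻¹ * - N)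
      ≈⟨ solve 5 (λ b lam fm s⁻¹ N → con (+ 1) :* (b :* ((lam :- con (+ 1)) :- fm) :* s⁻¹ :* :- N)
                                    := ((con (+ 1) :+ fm) :- lam) :* (b :* N :* s⁻¹)) refl _ lam (fromℕ m) _ N ⟩
    (s - lam) * (binom x m * N * s ⁻¹)            ∎
    where
    s s′ x N : Carrier
    s  = fromℕ (suc m)
    s′ = fromℕ (suc (suc m))
    x  = lam - 1#
    N  = negOnePow m

  -- (1 − t) f′(t) = (1 − t)^λ = 1 − λ f(t) for f(t) = −log_λ(1 − t).
  D-negDegLogCoeff : ∀ n → D a n ≈ δ n - lam * a n
  D-negDegLogCoeff zero = begin
    fromℕ 1 * a 1 - 0# * 0#   ≈⟨ +-congʳ (*-congˡ negDegLogCoeff-1) ⟩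
    fromℕ 1 * 1# - 0# * 0#    ≈⟨ solve 1 (λ lam → (con (+ 1) :+ con (+ 0)) :* con (+ 1) :- con (+ 0) :* con (+ 0)
                                                 := con (+ 1) :- lam :* con (+ 0)) refl lam ⟩
    1# - lam * 0#             ∎
  D-negDegLogCoeff (suc m) = begin
    s′ * a (suc (suc m)) - s * a (suc m)      ≈⟨ +-congʳ (negDegLogCoeff-suc m) ⟩
    (s - lam) * a (suc m) - s * a (suc m)     ≈⟨ solve 3 (λ s lam x → (s :- lam) :* x :- s :* x := con (+ 0) :- lam :* x) refl s lam _ ⟩
    0# - lam * a (suc m)                      ∎
    where
    s s′ : Carrier
    s  = fromℕ (suc m)
    s′ = fromℕ (suc (suc m))

  D-powCoeff-zero : ∀ n → D (P 0) n ≈ 0#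
  D-powCoeff-zero zero    = solve 0 ((con (+ 1) :+ con (+ 0)) :* con (+ 0) :- con (+ 0) :* con (+ 1) := con (+ 0)) refl
  D-powCoeff-zero (suc n) = solve 1 (λ s → (con (+ 1) :+ s) :* con (+ 0) :- s :* con (+ 0) := con (+ 0)) refl (fromℕ (suc n))

  D-negDegLogCoeff-⋆ : ∀ w n → D (a ⋆ w) n ≈ w n - lam * (a ⋆ w) n + (a ⋆ D w) n
  D-negDegLogCoeff-⋆ w n = begin
    D (a ⋆ w) n                                              ≈⟨ D-⋆ a w n ⟩
    (D a ⋆ w) n + (a ⋆ D w) n                                ≈⟨ +-congʳ (⋆-congˡ w n D-negDegLogCoeff) ⟩
    ((λ i → δ i - lam * a i) ⋆ w) n + (a ⋆ D w) n            ≈⟨ +-congʳ (⋆-distribʳ-- δ (λ i → lam * a i) w n) ⟩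
    (δ ⋆ w) n - ((λ i → lam * a i) ⋆ w) n + (a ⋆ D w) n      ≈⟨ +-congʳ (+-cong (⋆-identityˡ w n) (-‿cong (⋆-homogeneousˡ lam a w n))) ⟩
    w n - lam * (a ⋆ w) n + (a ⋆ D w) n                      ∎

  fromℕ-*-⋆-powCoeff-pred : ∀ k n → fromℕ k * (a ⋆ P (k ∸ 1)) n ≈ fromℕ k * P k n
  fromℕ-*-⋆-powCoeff-pred zero    n = trans (zeroˡ _) (sym (zeroˡ _))
  fromℕ-*-⋆-powCoeff-pred (suc k) n = refl

  -- (1 − t)(f^k)′ = k f^(k−1) (1 − t) f′ = k f^(k−1) (1 − λ f).
  D-powCoeff : ∀ k n → D (P k) n ≈ fromℕ k * (P (k ∸ 1) n - lam * P k n)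
  D-powCoeff zero    n = trans (D-powCoeff-zero n) (sym (zeroˡ _))
  D-powCoeff (suc k) n = begin
    D (a ⋆ P k) n                                          ≈⟨ D-negDegLogCoeff-⋆ (P k) n ⟩
    P k n - lam * P (suc k) n + (a ⋆ D (P k)) n            ≈⟨ +-congˡ a⋆DPₖ ⟩
    P k n - lam * P (suc k) n + (fromℕ k * P k n - fromℕ k * (lam * P (suc k) n))
      ≈⟨ solve 4 (λ p lam p′ k → p :- lam :* p′ :+ (k :* p :- k :* (lam :* p′)) := (con (+ 1) :+ k) :* (p :- lam :* p′)) refl _ lam _ (fromℕ k) ⟩
    fromℕ (suc k) * (P k n - lam * P (suc k) n)            ∎
    where
    a⋆DPₖ : (a ⋆ D (P k)) n ≈ fromℕ k * P k n - fromℕ k * (lam * P (suc k) n)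
    a⋆DPₖ = begin
      (a ⋆ D (P k)) n                                                  ≈⟨ ⋆-congʳ a n (D-powCoeff k) ⟩
      (a ⋆ (λ m → fromℕ k * (P (k ∸ 1) m - lam * P k m))) n            ≈⟨ ⋆-homogeneousʳ (fromℕ k) a (λ m → P (k ∸ 1) m - lam * P k m) n ⟩
      fromℕ k * (a ⋆ (λ m → P (k ∸ 1) m - lam * P k m)) n              ≈⟨ *-congˡ (⋆-distribˡ-- a (P (k ∸ 1)) (λ m → lam * P k m) n) ⟩
      fromℕ k * ((a ⋆ P (k ∸ 1)) n - (a ⋆ (λ m → lam * P k m)) n)      ≈⟨ *-congˡ (+-congˡ (-‿cong (⋆-homogeneousʳ lam a (P k) n))) ⟩
      fromℕ k * ((a ⋆ P (k ∸ 1)) n - lam * P (suc k) n)                ≈⟨ x[y-z]≈xy-xz _ _ _ ⟩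
      fromℕ k * (a ⋆ P (k ∸ 1)) n - fromℕ k * (lam * P (suc k) n)      ≈⟨ +-congʳ (fromℕ-*-⋆-powCoeff-pred k n) ⟩
      fromℕ k * P k n - fromℕ k * (lam * P (suc k) n)                  ∎

  powCoeff-vanish : ∀ k n → n < k → P k n ≈ 0#
  powCoeff-vanish zero    n ()
  powCoeff-vanish (suc k) n n<1+k = ⋆-vanish a (P k) k n refl (powCoeff-vanish k) (ℕ.s≤s⁻¹ n<1+k)

  β : ℕ → Carrier
  β j = degFalling 1# (- lam) j * fromℕ (j !) ⁻¹

  β-zero : β 0 ≈ 1#
  β-zero = trans (*-identityˡ _) fromℕ-1⁻¹

  β-suc : ∀ j → fromℕ (suc j) * β (suc j) ≈ (1# + fromℕ j * lam) * β j
  β-suc j = begin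
    s * (r * (1# - fromℕ j * - lam) * fromℕ (suc j !) ⁻¹)
      ≈⟨ solve 5 (λ s r fj lam u → s :* (r :* (con (+ 1) :- fj :* :- lam) :* u) := (con (+ 1) :+ fj :* lam) :* (r :* (s :* u))) refl s r (fromℕ j) lam _ ⟩
    (1# + fromℕ j * lam) * (r * (s * fromℕ (suc j !) ⁻¹))
      ≈⟨ *-congˡ (*-congˡ (fromℕ-suc*!-suc⁻¹ j)) ⟩
    (1# + fromℕ j * lam) * β j
      ∎
    where
    s r : Carrier
    s = fromℕ (suc j)
    r = degFalling 1# (- lam) j

  partialComposite : ℕ → ℕ → Carrier
  partialComposite N m = sumBelow N (λ j → β j * P j m)

  partialComposite-zero : ∀ N → partialComposite (suc N) 0 ≈ 1#
  partialComposite-zero N = begin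
    partialComposite (suc N) 0                                ≈⟨ sumBelow-head N _ ⟩
    β 0 * 1# + sumBelow N (λ j → β (suc j) * P (suc j) 0)
      ≈⟨ +-cong (trans (*-identityʳ _) β-zero) (sumBelow-zero N (λ j _ → trans (*-congˡ (powCoeff-vanish (suc j) 0 (s≤s z≤n))) (zeroʳ _))) ⟩
    1# + 0#                                                   ≈⟨ +-identityʳ 1# ⟩
    1#                                                        ∎

  telescopingTerm : ℕ → ℕ → Carrier
  telescopingTerm j m = fromℕ j * β j * P (j ∸ 1) m

  euler-partialComposite-suc : ∀ N m →
    fromℕ (suc m) * partialComposite N (suc m) ≈ fromℕ (suc m) * partialComposite N m - telescopingTerm N m
  euler-partialComposite-suc N m = begin
    s * partialComposite N (suc m)
      ≈⟨ *-distribˡ-sumBelow N s _ ⟩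
    sumBelow N (λ j → s * (β j * P j (suc m)))
      ≈⟨ sumBelow-cong N (λ j _ → term j) ⟩
    sumBelow N (λ j → s * (β j * P j m) + (e j - e (suc j)))
      ≈⟨ sumBelow-distrib-+ N _ _ ⟩
    sumBelow N (λ j → s * (β j * P j m)) + sumBelow N (λ j → e j - e (suc j))
      ≈⟨ +-cong (sym (*-distribˡ-sumBelow N s _)) (sumBelow-telescope N e) ⟩
    s * partialComposite N m + (e 0 - e N)
      ≈⟨ +-congˡ (+-congʳ (trans (*-congʳ (zeroˡ _)) (zeroˡ _))) ⟩
    s * partialComposite N m + (0# - e N)
      ≈⟨ solve 2 (λ x y → x :+ (con (+ 0) :- y) := x :- y) refl _ _ ⟩
    s * partialComposite N m - e N
      ∎
    where
    s : Carrier
    s = fromℕ (suc m)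
    e : ℕ → Carrier
    e j = telescopingTerm j m
    term : ∀ j → s * (β j * P j (suc m)) ≈ s * (β j * P j m) + (e j - e (suc j))
    term j = begin
      s * (b * p′)                                         ≈⟨ solve 4 (λ fm b p′ p → (con (+ 1) :+ fm) :* (b :* p′)
                                                                := b :* ((con (+ 1) :+ fm) :* p′ :- fm :* p) :+ (con (+ 1) :+ fm) :* (b :* p) :- b :* p) refl (fromℕ m) b p′ p ⟩
      b * D (P j) m + s * (b * p) - b * p                  ≈⟨ +-congʳ (+-congʳ (*-congˡ (D-powCoeff j m))) ⟩
      b * (fromℕ j * (q - lam * p)) + s * (b * p) - b * p  ≈⟨ solve 6 (λ b fj q lam p sbp → b :* (fj :* (q :- lam :* p)) :+ sbp :- b :* p
                                                                := sbp :+ (fj :* b :* q :- (con (+ 1) :+ fj :* lam) :* b :* p)) refl b (fromℕ j) q lam p _ ⟩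
      s * (b * p) + (e j - (1# + fromℕ j * lam) * b * p)   ≈⟨ +-congˡ (+-congˡ (-‿cong (*-congʳ (β-suc j)))) ⟨
      s * (b * p) + (e j - e (suc j))                      ∎
      where
      b p p′ q : Carrier
      b  = β j
      p  = P j m
      p′ = P j (suc m)
      q  = P (j ∸ 1) m

  partialComposite-suc : ∀ N m → suc m < N → partialComposite N (suc m) ≈ partialComposite N m
  partialComposite-suc (suc N) m (s≤s 1+m≤N) = *-cancelˡ (charZero m) (begin
    s * partialComposite (suc N) (suc m)                        ≈⟨ euler-partialComposite-suc (suc N) m ⟩
    s * partialComposite (suc N) m - telescopingTerm (suc N) m  ≈⟨ +-congˡ (-‿cong tail≈0) ⟩
    s * partialComposite (suc N) m - 0#                         ≈⟨ +-congˡ -0#≈0# ⟩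
    s * partialComposite (suc N) m + 0#                         ≈⟨ +-identityʳ _ ⟩
    s * partialComposite (suc N) m                              ∎)
    where
    s : Carrier
    s = fromℕ (suc m)
    tail≈0 : telescopingTerm (suc N) m ≈ 0#
    tail≈0 = trans (*-congˡ (powCoeff-vanish N m 1+m≤N)) (zeroʳ _)

  partialComposite≈1 : ∀ N m → m < N → partialComposite N m ≈ 1#
  partialComposite≈1 (suc N) zero    _     = partialComposite-zero N
  partialComposite≈1 N       (suc m) 1+m<N =
    trans (partialComposite-suc N m 1+m<N) (partialComposite≈1 N m (ℕ.<-trans (ℕ.n<1+n m) 1+m<N))

  degHarmonic≈sumBelow : ∀ n → degHarmonic n lam ≈ sumBelow n (a ∘ suc)
  degHarmonic≈sumBelow n = sum1to≈sumBelow n _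

  weightedStirlingSum : ∀ n →
    sum1to n (λ k → fromℕ k * degFalling 1# (- lam) (k ∸ 1) * degStirling1 lam n k)
      ≈ fromℕ (n !) * sumBelow n (λ j → β j * P (suc j) n)
  weightedStirlingSum n = begin
    sum1to n (λ k → fromℕ k * degFalling 1# (- lam) (k ∸ 1) * degStirling1 lam n k)
      ≈⟨ sum1to≈sumBelow n _ ⟩
    sumBelow n (λ j → fromℕ (suc j) * degFalling 1# (- lam) j * degStirling1 lam n (suc j))
      ≈⟨ sumBelow-cong n (λ j _ → term j) ⟩
    sumBelow n (λ j → fromℕ (n !) * (β j * P (suc j) n))
      ≈⟨ *-distribˡ-sumBelow n (fromℕ (n !)) _ ⟨
    fromℕ (n !) * sumBelow n (λ j → β j * P (suc j) n)
      ∎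
    where
    term : ∀ j → fromℕ (suc j) * degFalling 1# (- lam) j * degStirling1 lam n (suc j) ≈ fromℕ (n !) * (β j * P (suc j) n)
    term j = begin
      s * r * (n! * u * p)             ≈⟨ solve 5 (λ s r n! u p → s :* r :* (n! :* u :* p) := n! :* (r :* (s :* u) :* p)) refl s r n! u p ⟩
      n! * (r * (s * u) * p)           ≈⟨ *-congˡ (*-congʳ (*-congˡ (fromℕ-suc*!-suc⁻¹ j))) ⟩
      n! * (r * fromℕ (j !) ⁻¹ * p)    ∎
      where
      s r n! u p : Carrier
      s  = fromℕ (suc j)
      r  = degFalling 1# (- lam) j
      n! = fromℕ (n !)
      u  = fromℕ (suc j !) ⁻¹
      p  = P (suc j) n

-- The hypothesis λ ≢ 0 is not needed: the coefficient identities hold for every λ.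
theorem2p10 : ∀ {c ℓ} (F : CharZeroField c ℓ) → let open CharZeroField F in let open FieldDefs F in
    (lam : Carrier) → ¬ (lam ≈ 0#) → (n : ℕ) →
      degHarmonic n lam
        ≈ (fromℕ (n !) ⁻¹)
          * sum1to n (λ k → fromℕ k * degFalling 1# (- lam) (k ∸ 1) * degStirling1 lam n k)
theorem2p10 F lam _ n = begin
  degHarmonic n lam                                    ≈⟨ degHarmonic≈sumBelow n ⟩
  sumBelow n (a ∘ suc)                                 ≈⟨ ⋆-partialSum a (partialComposite n) n refl (partialComposite≈1 n) ⟨
  (a ⋆ partialComposite n) n                           ≈⟨ sumBelow-⋆ʳ n β a P n ⟨
  V                                                    ≈⟨ ⁻¹-*-cancelˡ V (fromℕ-≉0 (n !) {{ℕ._!≢0 n}}) ⟨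
  fromℕ (n !) ⁻¹ * (fromℕ (n !) * V)                   ≈⟨ *-congˡ (weightedStirlingSum n) ⟨
  fromℕ (n !) ⁻¹ * sum1to n (λ k → fromℕ k * degFalling 1# (- lam) (k ∸ 1) * degStirling1 lam n k) ∎
  where
  open CharZeroField F
  open FieldDefs F
  open CharZeroFieldProperties F
  open SumBelowProperties commutativeRing
  open Convolution commutativeRing
  open DegenerateLogSeries F lam
  open import Relation.Binary.Reasoning.Setoid setoid
  V : Carrier
  V = sumBelow n (λ j → β j * P (suc j) n)
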